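{- For every positive integer $n$, $$\sum_{k=1}^{n}(k-1)!\,c(n,k)\,q^{k-1}=\sum_{T\in\mathrm{inc}(n)}\mathrm{rgf}_{L_T}(q).$$
   Context: $c(n,k)$ denotes the (unsigned) Stirling number of the first kind: the number of permutations of $\{1,\dots,n\}$ with exactly $k$ cycles. $\mathrm{inc}(n)$ is the set of increasing trees on labels $1,\dots,n$: rooted trees with vertices labelled bijectively by $1,\dots,n$, root labelled $1$, each vertex having a larger label than its parent. For a rooted tree $T$, a pruning of $T$ is a rooted tree with the same root whose edge set is a subset of the edges of $T$ (i.e. a connected subtree containing the root). $L_T$ is the set of prunings of $T$ ordered by inclusion of edge sets (a distributive lattice), and its rank-generating function is $\mathrm{rgf}_{L_T}(q)=\sum_{S\in L_T} q^{e(S)}$, where $e(S)$ is the number of edges of $S$ (the rank of $S$ in $L_T$). -}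

module Defs where

open import Data.Nat using (ℕ; zero; suc; _+_; _*_; _∸_; _^_; _≤ᵇ_; _≡ᵇ_)
open import Data.Nat.Properties renaming (_≟_ to _≟ℕ_) using ()
open import Data.Bool using (Bool; true; false; _∧_; _∨_; not)
open import Data.Fin using (Fin; zero; suc; toℕ; inject₁; lower₁)
import Data.Fin
open import Data.Vec using (Vec; []; _∷_; lookup)
open import Data.List using (List; []; _∷_; map; concatMap; filterᵇ; length; allFin)
open import Data.Nat.ListAction using (sum)
open import Data.Bool.ListAction using (and)
open import Relation.Nullary using (yes; no)
open import Relation.Nullary.Decidable using (⌊_⌋)
open import Relation.Binary.PropositionalEquality using (sym)
open import Function using (_∘_)

-- Labels: we use 0-based labels 0,…,n-1 (Fin n) instead of 1,…,n.

allVecs : (m k : ℕ) → List (Vec (Fin m) k)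
allVecs m zero    = [] ∷ []
allVecs m (suc k) = concatMap (λ x → map (x ∷_) (allVecs m k)) (allFin m)

-- σ (as a vector of images) is injective, hence a permutation of Fin n.
isPerm : ∀ {n} → Vec (Fin n) n → Bool
isPerm {n} σ = and (map (λ i → and (map (λ j →
  not ⌊ lookup σ i Data.Fin.≟ lookup σ j ⌋ ∨ ⌊ i Data.Fin.≟ j ⌋) (allFin n))) (allFin n))

iter : ∀ {n} → Vec (Fin n) n → ℕ → Fin n → Fin n
iter σ zero    i = i
iter σ (suc m) i = lookup σ (iter σ m i)

-- i is the smallest element of its cycle (orbit {σ^m i}); each cycle has exactly one
-- such element, so the number of cycles of σ is the number of such i.
isCycleMin : ∀ {n} → Vec (Fin n) n → Fin n → Bool
isCycleMin {n} σ i = and (map (λ m → toℕ i ≤ᵇ toℕ (iter σ m i)) (Data.List.upTo n))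

numCycles : ∀ {n} → Vec (Fin n) n → ℕ
numCycles {n} σ = length (filterᵇ (isCycleMin σ) (allFin n))

stirling1 : ℕ → ℕ → ℕ
stirling1 n k = length (filterᵇ (λ σ → isPerm σ ∧ (numCycles σ ≡ᵇ k)) (allVecs n n))

-- Increasing trees on vertex set Fin n, root 0, every vertex larger than its parent.
-- Such a tree is determined by its parent function; it is built by adding the
-- vertices 1, 2, … in order, each attached to a previously added vertex.

data IncTree : ℕ → Set where
  root : IncTree 1
  grow : ∀ {n} → IncTree n → Fin n → IncTree (suc n)   -- new vertex n, parent given

incTrees : (n : ℕ) → List (IncTree n)
incTrees zero          = []
incTrees (suc zero)    = root ∷ []
incTrees (suc (suc n)) = concatMap (λ t → map (grow t) (allFin (suc n))) (incTrees (suc n))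

-- parent of a vertex; by convention the root is its own parent.
parent : ∀ {n} → IncTree n → Fin n → Fin n
parent root       i = i
parent {suc n} (grow t p) i with n ≟ℕ toℕ i
... | yes _ = inject₁ p
... | no ne = inject₁ (parent t (lower₁ i ne))

rootV : ∀ {n} → IncTree n → Fin n
rootV root       = zero
rootV (grow t p) = inject₁ (rootV t)

allSubsets : (n : ℕ) → List (Vec Bool n)
allSubsets zero    = [] ∷ []
allSubsets (suc n) = concatMap (λ S → (true ∷ S) ∷ (false ∷ S) ∷ []) (allSubsets n)

-- A pruning of T is identified with its vertex set S: S contains the root and is
-- closed under taking parents (its edges are the T-edges {parent v, v}, v ∈ S, v ≠ root).
isPruning : ∀ {n} → IncTree n → Vec Bool n → Bool
isPruning {n} t S = lookup S (rootV t) ∧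
  and (map (λ i → not (lookup S i) ∨ lookup S (parent t i)) (allFin n))

card : ∀ {n} → Vec Bool n → ℕ
card []          = 0
card (true ∷ S)  = suc (card S)
card (false ∷ S) = card S

edges : ∀ {n} → Vec Bool n → ℕ
edges S = card S ∸ 1

rgf : ∀ {n} → IncTree n → ℕ → ℕ
rgf {n} t q = sum (map (λ S → q ^ edges S) (filterᵇ (isPruning t) (allSubsets n)))

_! : ℕ → ℕ
zero  ! = 1
suc n ! = suc n * n !

lhs : ℕ → ℕ → ℕ
lhs n q = sum (map (λ k → (k ∸ 1) ! * stirling1 n k * q ^ (k ∸ 1)) (map suc (Data.List.upTo n)))

private
  open import Relation.Binary.PropositionalEquality using (_≡_; refl)
  _ : map (stirling1 4) (0 ∷ 1 ∷ 2 ∷ 3 ∷ 4 ∷ []) ≡ 0 ∷ 6 ∷ 11 ∷ 6 ∷ 1 ∷ []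
  _ = refl
  _ : lhs 4 2 ≡ sum (map (λ T → rgf T 2) (incTrees 4))
  _ = refl
  _ : length (incTrees 4) ≡ 6
  _ = refl

{-# OPTIONS --safe #-}
-- Both sides are instances of one recursion in n. Give a permutation with k cycles the
-- weight (k-1)! g(k) and a pruning with j vertices the weight g(j), for an arbitrary
-- g : ℕ → ℕ. A permutation of n+2 points arises exactly once from a permutation of the
-- other n+1 by inserting the largest point either as a new fixed point or right after one
-- of the n+1 old points; counting cycles by their minima, only the first choice adds a
-- cycle, since the largest point is the minimum of no other cycle. An increasing tree on
-- n+2 vertices arises exactly once by hanging the largest vertex below one of the n+1
-- others, and the prunings of the new tree are the prunings S of the old one, together
-- with S plus the new leaf when its parent lies in S. In both cases the weighted sum for
-- n+2 points and weight g is the sum for n+1 points and weight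
-- j ↦ (n+1) g(j) + j g(j+1), and for one point both sums are g(1). The theorem is the
-- case g(j) = q^(j-1), once the left-hand side is regrouped by number of cycles.
module Submission where

open import Defs
open import Data.Bool using (Bool; true; false; _∧_; _∨_; not; if_then_else_; T)
open import Data.Bool.ListAction using (and; all)
open import Data.Bool.Properties using (∧-assoc; ∧-identityʳ; T-≡)
open import Data.Empty using (⊥-elim)
open import Data.Fin as Fin using (Fin; zero; suc; toℕ; fromℕ; inject₁)
open import Data.Fin.Permutation.Components using (transpose; transpose-inverse)
import Data.Fin.Properties as Fin
open import Data.Fin.Relation.Unary.Top using (view; view-fromℕ; view-inject₁; ‵fromℕ; ‵inject₁)
open import Data.List using (List; []; _∷_; _++_; upTo; map; concatMap; filterᵇ; length; allFin; tabulate; cartesianProductWith)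
import Data.List.Properties as List
open import Data.List.Membership.Propositional using (_∈_)
open import Data.List.Membership.Propositional.Properties
  using (∈-map⁺; ∈-upTo⁺; ∈-filter⁺; ∈-filter⁻; ∈-allFin; ∈-cartesianProductWith⁺; ∈-cartesianProductWith⁻)
open import Data.List.Membership.Propositional.Properties.WithK using (unique∧set⇒bag)
open import Data.List.Relation.Binary.BagAndSetEquality using (∼bag⇒↭)
open import Data.List.Relation.Binary.Permutation.Propositional using (_↭_; ↭-sym)
import Data.List.Relation.Binary.Permutation.Propositional.Properties as ↭
open import Data.List.Relation.Unary.All as All using (All; []; _∷_)
open import Data.List.Relation.Unary.All.Properties using (all⁺; all⁻; applyUpTo⁺₁; applyUpTo⁻; tabulate⁺; tabulate⁻)
open import Data.List.Relation.Unary.AllPairs as AllPairs using (_∷_)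
open import Data.List.Relation.Unary.Any using (here; there)
open import Data.List.Relation.Unary.Unique.Propositional using (Unique)
import Data.List.Relation.Unary.Unique.Propositional.Properties as Unique
open import Data.Nat using (ℕ; zero; suc; _+_; _*_; _∸_; _^_; _≤_; _<_; z≤n; s≤s; z<s; s≤s⁻¹; _≡ᵇ_; _≤ᵇ_)
open import Data.Nat.GeneralisedArithmetic using (fold; fold-+)
open import Data.Nat.ListAction using (sum)
open import Data.Nat.ListAction.Properties using (sum-++; sum-↭)
open import Data.Nat.Properties
open import Algebra.Properties.CommutativeSemigroup +-commutativeSemigroup using () renaming (interchange to +-interchange)
open import Algebra.Properties.CommutativeSemigroup *-commutativeSemigroup using () renaming (xy∙z≈xz∙y to *-right-comm)
open import Algebra.Properties.Semiring.Sum +-*-semiring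
  using (sum-syntax; sum-cong-≗; *-distribʳ-sum; ∑-distrib-+; sum-init-last; sum-replicate-zero)
open import Data.Nat.Solver using (module +-*-Solver)
open import Data.Product using (∃-syntax; _×_; _,_; proj₁; proj₂)
open import Data.Sum using (_⊎_; inj₁; inj₂)
open import Data.Vec as Vec using (Vec; []; _∷_; _∷ʳ_; lookup)
import Data.Vec.Properties as Vec
open import Function using (_∘_; _⇔_; mk⇔; Equivalence)
open import Function.Construct.Composition using (_⇔-∘_)
open import Function.Construct.Symmetry using (⇔-sym)
open import Function.Definitions using (Injective)
open import Relation.Binary.PropositionalEquality
open import Relation.Nullary using (yes; no)
open import Relation.Nullary.Decidable using (⌊_⌋; isYes≗does; dec-true; dec-false; toWitness; fromWitness; T?)

private variable
  A B C : Set
  n : ℕ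

𝟙 : Bool → ℕ
𝟙 b = if b then 1 else 0

sum-map-cong : {f g : A → ℕ} → (∀ x → f x ≡ g x) → ∀ xs → sum (map f xs) ≡ sum (map g xs)
sum-map-cong f≗g xs = cong sum (List.map-cong f≗g xs)

sum-map-+ : ∀ (f g : A → ℕ) xs → sum (map (λ x → f x + g x) xs) ≡ sum (map f xs) + sum (map g xs)
sum-map-+ f g []       = refl
sum-map-+ f g (x ∷ xs) =
  trans (cong (f x + g x +_) (sum-map-+ f g xs)) (+-interchange (f x) (g x) _ _)

sum-map-concatMap : ∀ (f : B → ℕ) (h : A → List B) xs →
  sum (map f (concatMap h xs)) ≡ sum (map (λ x → sum (map f (h x))) xs)
sum-map-concatMap f h []       = refl
sum-map-concatMap f h (x ∷ xs) = begin
  sum (map f (h x ++ concatMap h xs))                         ≡⟨ cong sum (List.map-++ f (h x) _) ⟩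
  sum (map f (h x) ++ map f (concatMap h xs))                 ≡⟨ sum-++ (map f (h x)) _ ⟩
  sum (map f (h x)) + sum (map f (concatMap h xs))            ≡⟨ cong (sum (map f (h x)) +_) (sum-map-concatMap f h xs) ⟩
  sum (map f (h x)) + sum (map (λ x → sum (map f (h x))) xs)  ∎
  where open ≡-Reasoning

sum-map-filterᵇ : ∀ (p : A → Bool) (f : A → ℕ) xs →
  sum (map f (filterᵇ p xs)) ≡ sum (map (λ x → if p x then f x else 0) xs)
sum-map-filterᵇ p f []       = refl
sum-map-filterᵇ p f (x ∷ xs) with p x
... | true  = cong (f x +_) (sum-map-filterᵇ p f xs)
... | false = sum-map-filterᵇ p f xs

length-filterᵇ : ∀ (p : A → Bool) xs → length (filterᵇ p xs) ≡ sum (map (𝟙 ∘ p) xs)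
length-filterᵇ p []       = refl
length-filterᵇ p (x ∷ xs) with p x
... | true  = cong suc (length-filterᵇ p xs)
... | false = length-filterᵇ p xs

sum-tabulate : ∀ (f : Fin n → ℕ) → sum (tabulate f) ≡ ∑[ i < n ] f i
sum-tabulate {zero}  f = refl
sum-tabulate {suc n} f = cong (f zero +_) (sum-tabulate (f ∘ suc))

sum-map-allFin : ∀ (f : Fin n → ℕ) → sum (map f (allFin n)) ≡ ∑[ i < n ] f i
sum-map-allFin f = trans (cong sum (List.map-tabulate (λ i → i) f)) (sum-tabulate f)

∑-const : ∀ n x → ∑[ i < n ] x ≡ n * x
∑-const zero    x = refl
∑-const (suc n) x = cong (x +_) (∑-const n x)

∑-sum-map-comm : ∀ (F : Fin n → A → ℕ) xs →
  ∑[ i < n ] sum (map (F i) xs) ≡ sum (map (λ x → ∑[ i < n ] F i x) xs)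
∑-sum-map-comm {n} F []       = sum-replicate-zero n
∑-sum-map-comm     F (x ∷ xs) =
  trans (∑-distrib-+ (λ i → F i x) _) (cong (∑[ i < _ ] F i x +_) (∑-sum-map-comm F xs))

concatMap-map≡cartesianProductWith : ∀ (f : A → B → C) xs ys →
  concatMap (λ x → map (f x) ys) xs ≡ cartesianProductWith f xs ys
concatMap-map≡cartesianProductWith f []       ys = refl
concatMap-map≡cartesianProductWith f (x ∷ xs) ys =
  cong (map (f x) ys ++_) (concatMap-map≡cartesianProductWith f xs ys)

sum-map-zero : {f : A → ℕ} {xs : List A} → All (λ x → f x ≡ 0) xs → sum (map f xs) ≡ 0
sum-map-zero []            = refl
sum-map-zero (fx≡0 ∷ f≡0s) = cong₂ _+_ fx≡0 (sum-map-zero f≡0s)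

sum-indicator : ∀ (a : ℕ → ℕ) {v ks} → Unique ks → v ∈ ks → sum (map (λ k → a k * 𝟙 (v ≡ᵇ k)) ks) ≡ a v
sum-indicator a {v} = go
  where
  on : a v * 𝟙 (v ≡ᵇ v) ≡ a v
  on = trans (cong (λ b → a v * 𝟙 b) (dec-true (v ≟ v) refl)) (*-identityʳ (a v))
  off : ∀ {k} → v ≢ k → a k * 𝟙 (v ≡ᵇ k) ≡ 0
  off {k} v≢k = trans (cong (λ b → a k * 𝟙 b) (dec-false (v ≟ k) v≢k)) (*-zeroʳ (a k))
  go : ∀ {ks} → Unique ks → v ∈ ks → sum (map (λ k → a k * 𝟙 (v ≡ᵇ k)) ks) ≡ a v
  go (v∉ks ∷ _)   (here refl)  = trans (cong₂ _+_ on (sum-map-zero (All.map off v∉ks))) (+-identityʳ (a v))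
  go (k∉ks ∷ uks) (there v∈ks) = cong₂ _+_ (off (λ v≡k → All.lookup k∉ks v∈ks (sym v≡k))) (go uks v∈ks)

sum-fibres : ∀ {A : Set} (P : A → Bool) (f : A → ℕ) (a : ℕ → ℕ) {ks} →
  Unique ks → (∀ x → T (P x) → f x ∈ ks) → ∀ xs →
  sum (map (λ k → a k * length (filterᵇ (λ x → P x ∧ (f x ≡ᵇ k)) xs)) ks) ≡ sum (map (a ∘ f) (filterᵇ P xs))
sum-fibres {A} P f a {ks} uks f∈ks xs = begin
  sum (map (λ k → a k * length (filterᵇ (Q k) xs)) ks)
    ≡⟨ sum-map-cong (λ k → cong (a k *_) (length-filterᵇ (Q k) xs)) ks ⟩
  sum (map (λ k → a k * sum (map (𝟙 ∘ Q k) xs)) ks)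
    ≡⟨ regroup xs ⟩
  sum (map (λ x → if P x then a (f x) else 0) xs)
    ≡⟨ sum-map-filterᵇ P (a ∘ f) xs ⟨
  sum (map (a ∘ f) (filterᵇ P xs)) ∎
  where
  open ≡-Reasoning
  Q : ℕ → A → Bool
  Q k x = P x ∧ (f x ≡ᵇ k)
  fibre : ∀ x → sum (map (λ k → a k * 𝟙 (Q k x)) ks) ≡ (if P x then a (f x) else 0)
  fibre x with P x in px
  ... | true  = sum-indicator a uks (f∈ks x (subst T (sym px) _))
  ... | false = sum-map-zero {xs = ks} (All.tabulate (λ {k} _ → *-zeroʳ (a k)))
  regroup : ∀ xs → sum (map (λ k → a k * sum (map (𝟙 ∘ Q k) xs)) ks) ≡ sum (map (λ x → if P x then a (f x) else 0) xs)
  regroup []       = sum-map-zero {xs = ks} (All.tabulate (λ {k} _ → *-zeroʳ (a k)))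
  regroup (x ∷ xs) = begin
    sum (map (λ k → a k * (𝟙 (Q k x) + sum (map (𝟙 ∘ Q k) xs))) ks)
      ≡⟨ sum-map-cong (λ k → *-distribˡ-+ (a k) _ _) ks ⟩
    sum (map (λ k → a k * 𝟙 (Q k x) + a k * sum (map (𝟙 ∘ Q k) xs)) ks)
      ≡⟨ sum-map-+ _ _ ks ⟩
    sum (map (λ k → a k * 𝟙 (Q k x)) ks) + sum (map (λ k → a k * sum (map (𝟙 ∘ Q k) xs)) ks)
      ≡⟨ cong₂ _+_ (fibre x) (regroup xs) ⟩
    (if P x then a (f x) else 0) + sum (map (λ x → if P x then a (f x) else 0) xs) ∎

-- Extending and inserting into endomaps of Fin n

transpose-matchˡ : ∀ (i j : Fin n) → transpose i j i ≡ j
transpose-matchˡ i j rewrite dec-true (i Fin.≟ i) refl = refl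

transpose-matchʳ : ∀ (i j : Fin n) → transpose i j j ≡ i
transpose-matchʳ i j with j Fin.≟ i
... | yes j≡i = j≡i
... | no  _   rewrite dec-true (j Fin.≟ j) refl = refl

transpose-mismatch : ∀ {i j k : Fin n} → k ≢ i → k ≢ j → transpose i j k ≡ k
transpose-mismatch {i = i} {j} {k} k≢i k≢j rewrite dec-false (k Fin.≟ i) k≢i | dec-false (k Fin.≟ j) k≢j = refl

transpose-injective : ∀ (i j : Fin n) → Injective _≡_ _≡_ (transpose i j)
transpose-injective i j {x} {y} eq = begin
  x                                 ≡⟨ transpose-inverse j i ⟨
  transpose j i (transpose i j x)   ≡⟨ cong (transpose j i) eq ⟩
  transpose j i (transpose i j y)   ≡⟨ transpose-inverse j i ⟩
  y                                 ∎
  where open ≡-Reasoning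

extend : (Fin n → Fin n) → Fin (suc n) → Fin (suc n)
extend f i with view i
... | ‵fromℕ     = fromℕ _
... | ‵inject₁ j = inject₁ (f j)

extend-fromℕ : ∀ (f : Fin n → Fin n) → extend f (fromℕ n) ≡ fromℕ n
extend-fromℕ {n} f rewrite view-fromℕ n = refl

extend-inject₁ : ∀ (f : Fin n → Fin n) j → extend f (inject₁ j) ≡ inject₁ (f j)
extend-inject₁ f j rewrite view-inject₁ j = refl

extend-≡fromℕ : ∀ (f : Fin n → Fin n) i → extend f i ≡ fromℕ n → i ≡ fromℕ n
extend-≡fromℕ f i eq with view i
... | ‵fromℕ     = refl
... | ‵inject₁ j = ⊥-elim (Fin.fromℕ≢inject₁ (sym eq))

extend-injective : ∀ {f : Fin n → Fin n} → Injective _≡_ _≡_ f → Injective _≡_ _≡_ (extend f)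
extend-injective {f = f} f-inj {x} {y} eq with view x | view y
... | ‵fromℕ     | ‵fromℕ     = refl
... | ‵fromℕ     | ‵inject₁ _ = ⊥-elim (Fin.fromℕ≢inject₁ eq)
... | ‵inject₁ _ | ‵fromℕ     = ⊥-elim (Fin.fromℕ≢inject₁ (sym eq))
... | ‵inject₁ _ | ‵inject₁ _ = cong inject₁ (f-inj (Fin.inject₁-injective eq))

extend-injective⁻ : ∀ {f : Fin n → Fin n} → Injective _≡_ _≡_ (extend f) → Injective _≡_ _≡_ f
extend-injective⁻ {f = f} ext-inj {x} {y} eq =
  Fin.inject₁-injective (ext-inj (trans (extend-inject₁ f x) (trans (cong inject₁ eq) (sym (extend-inject₁ f y)))))

extend-cong : ∀ {f g : Fin n → Fin n} → (∀ x → f x ≡ g x) → ∀ i → extend f i ≡ extend g i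
extend-cong f≗g i with view i
... | ‵fromℕ     = refl
... | ‵inject₁ j = cong inject₁ (f≗g j)

fixes-fromℕ⇒≗extend : ∀ {g : Fin (suc n) → Fin (suc n)} → Injective _≡_ _≡_ g → g (fromℕ n) ≡ fromℕ n →
  ∃[ f ] (∀ i → extend f i ≡ g i)
fixes-fromℕ⇒≗extend {n} {g} g-inj g-fix = f , extend-f
  where
  g-inject₁≢fromℕ : ∀ j → n ≢ toℕ (g (inject₁ j))
  g-inject₁≢fromℕ j n≡ = Fin.fromℕ≢inject₁ (g-inj (trans g-fix (Fin.toℕ-injective (trans (Fin.toℕ-fromℕ n) n≡))))
  f : Fin n → Fin n
  f j = Fin.lower₁ (g (inject₁ j)) (g-inject₁≢fromℕ j)
  extend-f : ∀ i → extend f i ≡ g i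
  extend-f i with view i
  ... | ‵fromℕ     = sym g-fix
  ... | ‵inject₁ j = Fin.inject₁-lower₁ _ (g-inject₁≢fromℕ j)

-- The new point fromℕ n is put into the cycle of f right after c, or becomes a fixed point when c = fromℕ n.
insert : (Fin n → Fin n) → Fin (suc n) → Fin (suc n) → Fin (suc n)
insert f c = extend f ∘ transpose c (fromℕ _)

insert-at : ∀ (f : Fin n → Fin n) c → insert f c c ≡ fromℕ n
insert-at f c = trans (cong (extend f) (transpose-matchˡ c (fromℕ _))) (extend-fromℕ f)

insert-fromℕ : ∀ (f : Fin n → Fin n) c → insert f c (fromℕ n) ≡ extend f c
insert-fromℕ f c = cong (extend f) (transpose-matchʳ c (fromℕ _))

insert-inject₁ : ∀ (f : Fin n → Fin n) {c} j → inject₁ j ≢ c → insert f c (inject₁ j) ≡ inject₁ (f j)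
insert-inject₁ f j j≢c =
  trans (cong (extend f) (transpose-mismatch j≢c (Fin.fromℕ≢inject₁ ∘ sym))) (extend-inject₁ f j)

insert-after : ∀ (f : Fin n → Fin n) {c} j → inject₁ j ≡ c → insert f c (fromℕ n) ≡ inject₁ (f j)
insert-after f j refl = trans (insert-fromℕ f (inject₁ j)) (extend-inject₁ f j)

insert-≡fromℕ : ∀ (f : Fin n → Fin n) c i → insert f c i ≡ fromℕ n → i ≡ c
insert-≡fromℕ f c i eq = transpose-injective c (fromℕ _)
  (trans (extend-≡fromℕ f _ eq) (sym (transpose-matchˡ c (fromℕ _))))

insert-transpose : ∀ (f : Fin n → Fin n) c i → insert f c (transpose (fromℕ n) c i) ≡ extend f i
insert-transpose f c i = cong (extend f) (transpose-inverse c (fromℕ _) {i})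

insert-injective : ∀ {f : Fin n → Fin n} c → Injective _≡_ _≡_ f → Injective _≡_ _≡_ (insert f c)
insert-injective c f-inj = transpose-injective c (fromℕ _) ∘ extend-injective f-inj

injective⇒surjective : ∀ {f : Fin n → Fin n} → Injective _≡_ _≡_ f → ∀ y → ∃[ x ] f x ≡ y
injective⇒surjective {zero}  f-inj ()
injective⇒surjective {suc n} {f} f-inj y with Fin.any? (λ x → f x Fin.≟ y)
... | yes hit  = hit
... | no  miss = ⊥-elim (n≮n n (Fin.injective⇒≤ punchOut∘f-injective))
  where
  y≢f : ∀ x → y ≢ f x
  y≢f x y≡fx = miss (x , sym y≡fx)
  punchOut∘f-injective : Injective _≡_ _≡_ (λ x → Fin.punchOut (y≢f x))
  punchOut∘f-injective = f-inj ∘ Fin.punchOut-injective (y≢f _) (y≢f _)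

injective⇒≗insert : ∀ {σ : Fin (suc n) → Fin (suc n)} → Injective _≡_ _≡_ σ →
  ∃[ f ] ∃[ c ] Injective _≡_ _≡_ f × (∀ i → insert f c i ≡ σ i)
injective⇒≗insert {n} {σ} σ-inj with injective⇒surjective σ-inj (fromℕ n)
... | c , σc≡fromℕ = f , c , f-inj , insert-f
  where
  g : Fin (suc n) → Fin (suc n)
  g = σ ∘ transpose (fromℕ n) c
  g-inj : Injective _≡_ _≡_ g
  g-inj = transpose-injective (fromℕ n) c ∘ σ-inj
  g-fix : g (fromℕ n) ≡ fromℕ n
  g-fix = trans (cong σ (transpose-matchˡ (fromℕ n) c)) σc≡fromℕ
  f = proj₁ (fixes-fromℕ⇒≗extend g-inj g-fix)
  extend-f : ∀ i → extend f i ≡ g i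
  extend-f = proj₂ (fixes-fromℕ⇒≗extend g-inj g-fix)
  f-inj : Injective _≡_ _≡_ f
  f-inj = extend-injective⁻ (λ {x} {y} eq → g-inj (trans (sym (extend-f x)) (trans eq (extend-f y))))
  insert-f : ∀ i → insert f c i ≡ σ i
  insert-f i = trans (extend-f (transpose c (fromℕ n) i)) (cong σ (transpose-inverse (fromℕ n) c {i}))

-- Cycle minima

IsCycleMin : (Fin n → Fin n) → Fin n → Set
IsCycleMin f i = ∀ m → toℕ i ≤ toℕ (fold i f m)

fold-fixed : ∀ {f : A → A} {x} → f x ≡ x → ∀ m → fold x f m ≡ x
fold-fixed fx≡x zero    = refl
fold-fixed {f = f} fx≡x (suc m) = trans (cong f (fold-fixed fx≡x m)) fx≡x

fold-cong : ∀ {f g : A → A} → (∀ x → f x ≡ g x) → ∀ x m → fold x f m ≡ fold x g m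
fold-cong f≗g x zero    = refl
fold-cong {f = f} {g} f≗g x (suc m) = trans (cong f (fold-cong f≗g x m)) (f≗g _)

IsCycleMin-cong : ∀ {f g : Fin n → Fin n} → (∀ x → f x ≡ g x) → ∀ i → IsCycleMin f i ⇔ IsCycleMin g i
IsCycleMin-cong f≗g i = mk⇔
  (λ min m → subst (λ y → toℕ i ≤ toℕ y) (fold-cong f≗g i m) (min m))
  (λ min m → subst (λ y → toℕ i ≤ toℕ y) (sym (fold-cong f≗g i m)) (min m))

insert-orbit⊇ : ∀ (f : Fin n → Fin n) c j m → ∃[ m′ ] fold (inject₁ j) (insert f c) m′ ≡ inject₁ (fold j f m)
insert-orbit⊇ f c j zero    = 0 , refl
insert-orbit⊇ f c j (suc m) with insert-orbit⊇ f c j m | inject₁ (fold j f m) Fin.≟ c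
... | m′ , eq | no  y≢c = suc m′ , trans (cong (insert f c) eq) (insert-inject₁ f _ y≢c)
... | m′ , eq | yes y≡c = suc (suc m′) , (begin
  insert f c (insert f c (fold (inject₁ j) (insert f c) m′))  ≡⟨ cong (insert f c ∘ insert f c) (trans eq y≡c) ⟩
  insert f c (insert f c c)                                   ≡⟨ cong (insert f c) (insert-at f c) ⟩
  insert f c (fromℕ _)                                        ≡⟨ insert-after f _ y≡c ⟩
  inject₁ (f (fold j f m))                                    ∎)
  where open ≡-Reasoning

insert-orbit⊆ : ∀ (f : Fin n → Fin n) c j m →
  (∃[ m′ ] fold (inject₁ j) (insert f c) m ≡ inject₁ (fold j f m′)) ⊎
  (fold (inject₁ j) (insert f c) m ≡ fromℕ n × ∃[ m′ ] inject₁ (fold j f m′) ≡ c)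
insert-orbit⊆ f c j zero    = inj₁ (0 , refl)
insert-orbit⊆ f c j (suc m) with insert-orbit⊆ f c j m
... | inj₂ (eq , m′ , y≡c) = inj₁ (suc m′ , trans (cong (insert f c) eq) (insert-after f _ y≡c))
... | inj₁ (m′ , eq) with inject₁ (fold j f m′) Fin.≟ c
...   | yes y≡c = inj₂ (trans (cong (insert f c) (trans eq y≡c)) (insert-at f c) , m′ , y≡c)
...   | no  y≢c = inj₁ (suc m′ , trans (cong (insert f c) eq) (insert-inject₁ f _ y≢c))

isCycleMin-insert-inject₁ : ∀ (f : Fin n → Fin n) c j → IsCycleMin (insert f c) (inject₁ j) ⇔ IsCycleMin f j
isCycleMin-insert-inject₁ f c j = mk⇔ to from
  where
  to : IsCycleMin (insert f c) (inject₁ j) → IsCycleMin f j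
  to min m with m′ , eq ← insert-orbit⊇ f c j m =
    subst₂ _≤_ (Fin.toℕ-inject₁ j) (trans (cong toℕ eq) (Fin.toℕ-inject₁ _)) (min m′)
  from : IsCycleMin f j → IsCycleMin (insert f c) (inject₁ j)
  from min m with insert-orbit⊆ f c j m
  ... | inj₁ (m′ , eq) = subst₂ _≤_ (sym (Fin.toℕ-inject₁ j)) (sym (trans (cong toℕ eq) (Fin.toℕ-inject₁ _))) (min m′)
  ... | inj₂ (eq , _)  = subst (λ z → toℕ (inject₁ j) ≤ toℕ z) (sym eq) (Fin.≤fromℕ (inject₁ j))

isCycleMin-insert-fromℕ : ∀ (f : Fin n → Fin n) c → IsCycleMin (insert f c) (fromℕ n) ⇔ c ≡ fromℕ n
isCycleMin-insert-fromℕ {n} f c = mk⇔ to from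
  where
  to : IsCycleMin (insert f c) (fromℕ n) → c ≡ fromℕ n
  to min with view c
  ... | ‵fromℕ     = refl
  ... | ‵inject₁ i = ⊥-elim (<⇒≱ (Fin.inject₁ℕ< (f i)) (begin
    n                                     ≡⟨ Fin.toℕ-fromℕ n ⟨
    toℕ (fromℕ n)                         ≤⟨ min 1 ⟩
    toℕ (insert f (inject₁ i) (fromℕ n))  ≡⟨ cong toℕ (insert-after f i refl) ⟩
    toℕ (inject₁ (f i))                   ∎))
    where open ≤-Reasoning
  from : c ≡ fromℕ n → IsCycleMin (insert f c) (fromℕ n)
  from refl m = ≤-reflexive (cong toℕ (sym (fold-fixed (insert-at f (fromℕ n)) m)))

-- Two of the n + 1 points x, f x, …, fⁿ x coincide, which shortcuts the path to fⁿ x.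
fold-n-shortcut : ∀ (f : Fin n → Fin n) x → ∃[ r ] r < n × fold x f r ≡ fold x f n
fold-n-shortcut {n} f x with a , b , a<b , fa≡fb ← Fin.pigeonhole (n<1+n n) (λ k → fold x f (toℕ k)) =
  n ∸ toℕ b + toℕ a , shorter , (begin
    fold x f (n ∸ toℕ b + toℕ a)            ≡⟨ fold-+ x f (n ∸ toℕ b) ⟩
    fold (fold x f (toℕ a)) f (n ∸ toℕ b)   ≡⟨ cong (λ y → fold y f (n ∸ toℕ b)) fa≡fb ⟩
    fold (fold x f (toℕ b)) f (n ∸ toℕ b)   ≡⟨ fold-+ x f (n ∸ toℕ b) ⟨
    fold x f (n ∸ toℕ b + toℕ b)            ≡⟨ cong (fold x f) (m∸n+n≡m b≤n) ⟩
    fold x f n                              ∎)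
  where
  open ≡-Reasoning
  b≤n : toℕ b ≤ n
  b≤n = s≤s⁻¹ (Fin.toℕ<n b)
  shorter : n ∸ toℕ b + toℕ a < n
  shorter = subst (n ∸ toℕ b + toℕ a <_) (m∸n+n≡m b≤n) (+-monoʳ-< (n ∸ toℕ b) a<b)

fold-shortcut : ∀ (f : Fin n → Fin n) x m → ∃[ r ] r < n × fold x f r ≡ fold x f m
fold-shortcut {suc n} f x zero    = 0 , z<s , refl
fold-shortcut {n}     f x (suc m) with r , r<n , eq ← fold-shortcut f x m | suc r ≟ n
... | no  1+r≢n = suc r , ≤∧≢⇒< r<n 1+r≢n , cong f eq
... | yes refl with r′ , r′<n , eq′ ← fold-n-shortcut f x = r′ , r′<n , trans eq′ (cong f eq)

-- Permutations as vectors

T⇔T⇒≡ : ∀ {a b} → T a ⇔ T b → a ≡ b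
T⇔T⇒≡ {false} {false} _      = refl
T⇔T⇒≡ {false} {true}  a⇔b = ⊥-elim (Equivalence.from a⇔b _)
T⇔T⇒≡ {true}  {false} a⇔b = ⊥-elim (Equivalence.to a⇔b _)
T⇔T⇒≡ {true}  {true}  _      = refl

iter≡fold : ∀ (σ : Vec (Fin n) n) m i → iter σ m i ≡ fold i (lookup σ) m
iter≡fold σ zero    i = refl
iter≡fold σ (suc m) i = cong (lookup σ) (iter≡fold σ m i)

isCycleMin⇔IsCycleMin : ∀ (σ : Vec (Fin n) n) i → T (isCycleMin σ i) ⇔ IsCycleMin (lookup σ) i
isCycleMin⇔IsCycleMin {n} σ i = mk⇔ to from
  where
  below : ℕ → Bool
  below m = toℕ i ≤ᵇ toℕ (iter σ m i)
  to : T (isCycleMin σ i) → IsCycleMin (lookup σ) i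
  to min m with r , r<n , eq ← fold-shortcut (lookup σ) i m =
    subst (λ y → toℕ i ≤ toℕ y) (trans (iter≡fold σ r i) eq)
      (≤ᵇ⇒≤ (toℕ i) _ (applyUpTo⁻ {P = T ∘ below} (λ m → m) n (all⁺ below _ min) r<n))
  from : IsCycleMin (lookup σ) i → T (isCycleMin σ i)
  from min = all⁻ below (applyUpTo⁺₁ (λ m → m) n (λ {m} _ →
    ≤⇒≤ᵇ (subst (λ y → toℕ i ≤ toℕ y) (sym (iter≡fold σ m i)) (min m))))

isPerm⇔injective : ∀ (σ : Vec (Fin n) n) → T (isPerm σ) ⇔ Injective _≡_ _≡_ (lookup σ)
isPerm⇔injective {n} σ = mk⇔ to from
  where
  agree⇒equal : Fin n → Fin n → Bool
  agree⇒equal i j = not ⌊ lookup σ i Fin.≟ lookup σ j ⌋ ∨ ⌊ i Fin.≟ j ⌋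
  to : T (isPerm σ) → Injective _≡_ _≡_ (lookup σ)
  to perm {i} {j} σi≡σj = toWitness (subst (λ b → T (not b ∨ ⌊ i Fin.≟ j ⌋)) agree
    (tabulate⁻ (all⁺ (agree⇒equal i) _ (tabulate⁻ (all⁺ _ _ perm) i)) j))
    where
    agree : ⌊ lookup σ i Fin.≟ lookup σ j ⌋ ≡ true
    agree = trans (isYes≗does (_ Fin.≟ _)) (dec-true (_ Fin.≟ _) σi≡σj)
  from : Injective _≡_ _≡_ (lookup σ) → T (isPerm σ)
  from σ-inj = all⁻ _ (tabulate⁺ (λ i → all⁻ _ (tabulate⁺ (λ j → implies i j))))
    where
    implies : ∀ i j → T (agree⇒equal i j)
    implies i j with lookup σ i Fin.≟ lookup σ j
    ... | yes σi≡σj = fromWitness (σ-inj σi≡σj)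
    ... | no  _     = _

numCycles≡∑ : ∀ (σ : Vec (Fin n) n) → numCycles σ ≡ ∑[ i < n ] 𝟙 (isCycleMin σ i)
numCycles≡∑ σ = trans (length-filterᵇ (isCycleMin σ) (allFin _)) (sum-map-allFin (𝟙 ∘ isCycleMin σ))

insertᵥ : Vec (Fin n) n → Fin (suc n) → Vec (Fin (suc n)) (suc n)
insertᵥ σ c = Vec.tabulate (insert (lookup σ) c)

isCycleMin-insertᵥ⇔ : ∀ (σ : Vec (Fin n) n) c i → T (isCycleMin (insertᵥ σ c) i) ⇔ IsCycleMin (insert (lookup σ) c) i
isCycleMin-insertᵥ⇔ σ c i =
  IsCycleMin-cong (Vec.lookup∘tabulate (insert (lookup σ) c)) i ⇔-∘ isCycleMin⇔IsCycleMin (insertᵥ σ c) i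

isCycleMin-insertᵥ-inject₁ : ∀ (σ : Vec (Fin n) n) c j → isCycleMin (insertᵥ σ c) (inject₁ j) ≡ isCycleMin σ j
isCycleMin-insertᵥ-inject₁ σ c j = T⇔T⇒≡
  (⇔-sym (isCycleMin⇔IsCycleMin σ j) ⇔-∘
    (isCycleMin-insert-inject₁ (lookup σ) c j ⇔-∘ isCycleMin-insertᵥ⇔ σ c (inject₁ j)))

numCycles-insertᵥ : ∀ (σ : Vec (Fin n) n) c →
  numCycles (insertᵥ σ c) ≡ numCycles σ + 𝟙 (isCycleMin (insertᵥ σ c) (fromℕ n))
numCycles-insertᵥ {n} σ c = begin
  numCycles (insertᵥ σ c)
    ≡⟨ numCycles≡∑ (insertᵥ σ c) ⟩
  ∑[ i < suc n ] 𝟙 (isCycleMin (insertᵥ σ c) i)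
    ≡⟨ sum-init-last (𝟙 ∘ isCycleMin (insertᵥ σ c)) ⟩
  ∑[ j < n ] 𝟙 (isCycleMin (insertᵥ σ c) (inject₁ j)) + 𝟙 (isCycleMin (insertᵥ σ c) (fromℕ n))
    ≡⟨ cong (_+ 𝟙 (isCycleMin (insertᵥ σ c) (fromℕ n))) (sum-cong-≗ (cong 𝟙 ∘ isCycleMin-insertᵥ-inject₁ σ c)) ⟩
  ∑[ j < n ] 𝟙 (isCycleMin σ j) + 𝟙 (isCycleMin (insertᵥ σ c) (fromℕ n))
    ≡⟨ cong (_+ 𝟙 (isCycleMin (insertᵥ σ c) (fromℕ n))) (numCycles≡∑ σ) ⟨
  numCycles σ + 𝟙 (isCycleMin (insertᵥ σ c) (fromℕ n)) ∎
  where open ≡-Reasoning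

numCycles-insertᵥ-fromℕ : ∀ (σ : Vec (Fin n) n) → numCycles (insertᵥ σ (fromℕ n)) ≡ suc (numCycles σ)
numCycles-insertᵥ-fromℕ {n} σ =
  trans (numCycles-insertᵥ σ (fromℕ n)) (trans (cong (λ b → numCycles σ + 𝟙 b) isMin) (+-comm _ 1))
  where
  isMin : isCycleMin (insertᵥ σ (fromℕ n)) (fromℕ n) ≡ true
  isMin = T⇔T⇒≡ (mk⇔ _ (λ _ → Equivalence.from (isCycleMin-insertᵥ⇔ σ _ _)
    (Equivalence.from (isCycleMin-insert-fromℕ (lookup σ) (fromℕ n)) refl)))

numCycles-insertᵥ-inject₁ : ∀ (σ : Vec (Fin n) n) i → numCycles (insertᵥ σ (inject₁ i)) ≡ numCycles σ
numCycles-insertᵥ-inject₁ {n} σ i =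
  trans (numCycles-insertᵥ σ (inject₁ i)) (trans (cong (λ b → numCycles σ + 𝟙 b) notMin) (+-identityʳ _))
  where
  notMin : isCycleMin (insertᵥ σ (inject₁ i)) (fromℕ n) ≡ false
  notMin = T⇔T⇒≡ (mk⇔ (λ min → Fin.fromℕ≢inject₁ (sym
    (Equivalence.to (isCycleMin-insert-fromℕ (lookup σ) (inject₁ i)) (Equivalence.to (isCycleMin-insertᵥ⇔ σ _ _) min))))
    (λ ()))

injective-tabulate : ∀ {f : Fin n → Fin n} → Injective _≡_ _≡_ f → Injective _≡_ _≡_ (lookup (Vec.tabulate f))
injective-tabulate {f = f} f-inj {x} {y} eq =
  f-inj (trans (sym (Vec.lookup∘tabulate f x)) (trans eq (Vec.lookup∘tabulate f y)))

permutations : ∀ n → List (Vec (Fin n) n)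
permutations n = filterᵇ isPerm (allVecs n n)

allVecs-suc : ∀ m k → allVecs m (suc k) ≡ cartesianProductWith _∷_ (allFin m) (allVecs m k)
allVecs-suc m k = concatMap-map≡cartesianProductWith _∷_ (allFin m) (allVecs m k)

allVecs-unique : ∀ m k → Unique (allVecs m k)
allVecs-unique m zero    = [] ∷ AllPairs.[]
allVecs-unique m (suc k) = subst Unique (sym (allVecs-suc m k))
  (Unique.cartesianProductWith⁺ _∷_ Vec.∷-injective (Unique.allFin⁺ m) (allVecs-unique m k))

∈-allVecs : ∀ {m k} (v : Vec (Fin m) k) → v ∈ allVecs m k
∈-allVecs []            = here refl
∈-allVecs {m} {suc k} (x ∷ v) =
  subst (_ ∈_) (sym (allVecs-suc m k)) (∈-cartesianProductWith⁺ _∷_ (∈-allFin x) (∈-allVecs v))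

permutations-unique : ∀ n → Unique (permutations n)
permutations-unique n = Unique.filter⁺ (T? ∘ isPerm) (allVecs-unique n n)

∈-permutations : ∀ {σ : Vec (Fin n) n} → σ ∈ permutations n ⇔ Injective _≡_ _≡_ (lookup σ)
∈-permutations {n} {σ} = mk⇔ to from
  where
  to : σ ∈ permutations n → Injective _≡_ _≡_ (lookup σ)
  to σ∈ = Equivalence.to (isPerm⇔injective σ) (proj₂ (∈-filter⁻ (T? ∘ isPerm) {xs = allVecs n n} σ∈))
  from : Injective _≡_ _≡_ (lookup σ) → σ ∈ permutations n
  from σ-inj = ∈-filter⁺ (T? ∘ isPerm) (∈-allVecs σ) (Equivalence.from (isPerm⇔injective σ) σ-inj)

insertᵥ-injective₂ : ∀ {σ σ′ : Vec (Fin n) n} {c c′} → insertᵥ σ c ≡ insertᵥ σ′ c′ → σ ≡ σ′ × c ≡ c′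
insertᵥ-injective₂ {n} {σ} {σ′} {c} {c′} eq =
  trans (sym (Vec.tabulate∘lookup σ)) (trans (Vec.tabulate-cong lookup-agree) (Vec.tabulate∘lookup σ′)) , c≡c′
  where
  agree : ∀ i → insert (lookup σ) c i ≡ insert (lookup σ′) c′ i
  agree i = trans (sym (Vec.lookup∘tabulate (insert (lookup σ) c) i))
    (trans (cong (λ v → lookup v i) eq) (Vec.lookup∘tabulate (insert (lookup σ′) c′) i))
  c≡c′ : c ≡ c′
  c≡c′ = insert-≡fromℕ (lookup σ′) c′ c (trans (sym (agree c)) (insert-at (lookup σ) c))
  lookup-agree : ∀ j → lookup σ j ≡ lookup σ′ j
  lookup-agree j = Fin.inject₁-injective (begin
    inject₁ (lookup σ j)
      ≡⟨ extend-inject₁ (lookup σ) j ⟨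
    extend (lookup σ) (inject₁ j)
      ≡⟨ insert-transpose (lookup σ) c (inject₁ j) ⟨
    insert (lookup σ) c (transpose (fromℕ n) c (inject₁ j))
      ≡⟨ agree (transpose (fromℕ n) c (inject₁ j)) ⟩
    insert (lookup σ′) c′ (transpose (fromℕ n) c (inject₁ j))
      ≡⟨ cong (λ c″ → insert (lookup σ′) c′ (transpose (fromℕ n) c″ (inject₁ j))) c≡c′ ⟩
    insert (lookup σ′) c′ (transpose (fromℕ n) c′ (inject₁ j))
      ≡⟨ insert-transpose (lookup σ′) c′ (inject₁ j) ⟩
    extend (lookup σ′) (inject₁ j)
      ≡⟨ extend-inject₁ (lookup σ′) j ⟩
    inject₁ (lookup σ′ j) ∎)
    where open ≡-Reasoning

insertions : ∀ n → List (Vec (Fin (suc n)) (suc n))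
insertions n = cartesianProductWith insertᵥ (permutations n) (allFin (suc n))

insertions↭permutations : ∀ n → insertions n ↭ permutations (suc n)
insertions↭permutations n = ∼bag⇒↭ (unique∧set⇒bag
  (Unique.cartesianProductWith⁺ insertᵥ insertᵥ-injective₂ (permutations-unique n) (Unique.allFin⁺ (suc n)))
  (permutations-unique (suc n))
  (mk⇔ to from))
  where
  to : ∀ {v} → v ∈ insertions n → v ∈ permutations (suc n)
  to v∈ with σ , c , σ∈ , _ , refl ← ∈-cartesianProductWith⁻ insertᵥ (permutations n) (allFin (suc n)) v∈ =
    Equivalence.from ∈-permutations (injective-tabulate (insert-injective c (Equivalence.to ∈-permutations σ∈)))
  from : ∀ {v} → v ∈ permutations (suc n) → v ∈ insertions n
  from {v} v∈ = from-decomposition (injective⇒≗insert (Equivalence.to (∈-permutations {suc n} {v}) v∈))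
    where
    from-decomposition : (∃[ f ] ∃[ c ] Injective _≡_ _≡_ f × (∀ i → insert f c i ≡ lookup v i)) → v ∈ insertions n
    from-decomposition (f , c , f-inj , insert-f≗v) = subst (_∈ insertions n) insertᵥ≡v
      (∈-cartesianProductWith⁺ insertᵥ (Equivalence.from (∈-permutations {σ = Vec.tabulate f}) (injective-tabulate f-inj))
        (∈-allFin c))
      where
      insertᵥ≡v : insertᵥ (Vec.tabulate f) c ≡ v
      insertᵥ≡v = trans
        (Vec.tabulate-cong (λ i → trans (extend-cong (Vec.lookup∘tabulate f) (transpose c (fromℕ n) i)) (insert-f≗v i)))
        (Vec.tabulate∘lookup v)

-- Weighted sums over permutations

sum-insertᵥ : ∀ (W : ℕ → ℕ) (σ : Vec (Fin n) n) →
  ∑[ c < suc n ] W (numCycles (insertᵥ σ c)) ≡ W (suc (numCycles σ)) + n * W (numCycles σ)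
sum-insertᵥ {n} W σ = begin
  ∑[ c < suc n ] W (numCycles (insertᵥ σ c))
    ≡⟨ sum-init-last (W ∘ numCycles ∘ insertᵥ σ) ⟩
  ∑[ i < n ] W (numCycles (insertᵥ σ (inject₁ i))) + W (numCycles (insertᵥ σ (fromℕ n)))
    ≡⟨ cong₂ _+_ (sum-cong-≗ (cong W ∘ numCycles-insertᵥ-inject₁ σ)) (cong W (numCycles-insertᵥ-fromℕ σ)) ⟩
  ∑[ i < n ] W (numCycles σ) + W (suc (numCycles σ))
    ≡⟨ cong (_+ W (suc (numCycles σ))) (∑-const n (W (numCycles σ))) ⟩
  n * W (numCycles σ) + W (suc (numCycles σ))
    ≡⟨ +-comm (n * W (numCycles σ)) _ ⟩
  W (suc (numCycles σ)) + n * W (numCycles σ) ∎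
  where open ≡-Reasoning

sum-permutations-suc : ∀ n (W : ℕ → ℕ) → sum (map (W ∘ numCycles) (permutations (suc n))) ≡
  sum (map (λ σ → W (suc (numCycles σ)) + n * W (numCycles σ)) (permutations n))
sum-permutations-suc n W = begin
  sum (map (W ∘ numCycles) (permutations (suc n)))
    ≡⟨ sum-↭ (↭.map⁺ (W ∘ numCycles) (↭-sym (insertions↭permutations n))) ⟩
  sum (map (W ∘ numCycles) (cartesianProductWith insertᵥ (permutations n) (allFin (suc n))))
    ≡⟨ cong (sum ∘ map (W ∘ numCycles)) (concatMap-map≡cartesianProductWith insertᵥ (permutations n) (allFin (suc n))) ⟨
  sum (map (W ∘ numCycles) (concatMap (λ σ → map (insertᵥ σ) (allFin (suc n))) (permutations n)))
    ≡⟨ sum-map-concatMap (W ∘ numCycles) (λ σ → map (insertᵥ σ) (allFin (suc n))) (permutations n) ⟩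
  sum (map (λ σ → sum (map (W ∘ numCycles) (map (insertᵥ σ) (allFin (suc n))))) (permutations n))
    ≡⟨ sum-map-cong insertions-of (permutations n) ⟩
  sum (map (λ σ → W (suc (numCycles σ)) + n * W (numCycles σ)) (permutations n)) ∎
  where
  open ≡-Reasoning
  insertions-of : ∀ σ →
    sum (map (W ∘ numCycles) (map (insertᵥ σ) (allFin (suc n)))) ≡ W (suc (numCycles σ)) + n * W (numCycles σ)
  insertions-of σ = trans (cong sum (sym (List.map-∘ (allFin (suc n)))))
    (trans (sum-map-allFin (W ∘ numCycles ∘ insertᵥ σ)) (sum-insertᵥ W σ))

nextWeight : ℕ → (ℕ → ℕ) → ℕ → ℕ
nextWeight m g j = m * g j + j * g (suc j)

totalWeight : ℕ → (ℕ → ℕ) → ℕ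
totalWeight zero    g = g 1
totalWeight (suc n) g = totalWeight n (nextWeight (suc n) g)

cycleWeight : (ℕ → ℕ) → ℕ → ℕ
cycleWeight g k = (k ∸ 1) ! * g k

cycleWeightSum : ℕ → (ℕ → ℕ) → ℕ
cycleWeightSum n g = sum (map (cycleWeight g ∘ numCycles) (permutations n))

cycleWeight-next : ∀ m g {k} → 1 ≤ k → cycleWeight g (suc k) + m * cycleWeight g k ≡ cycleWeight (nextWeight m g) k
cycleWeight-next m g {suc k} _ =
  solve 5 (λ k k! m x y → (con 1 :+ k) :* k! :* y :+ m :* (k! :* x) := k! :* (m :* x :+ (con 1 :+ k) :* y))
    refl k (k !) m (g (suc k)) (g (suc (suc k)))
  where open +-*-Solver

numCycles-pos : ∀ (σ : Vec (Fin (suc n)) (suc n)) → 1 ≤ numCycles σ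
numCycles-pos {n} σ = subst (1 ≤_) (sym (numCycles≡∑ σ))
  (subst (λ b → 1 ≤ 𝟙 b + ∑[ i < n ] 𝟙 (isCycleMin σ (suc i))) (sym zero-isMin) (s≤s z≤n))
  where
  zero-isMin : isCycleMin σ zero ≡ true
  zero-isMin = Equivalence.to T-≡ (Equivalence.from (isCycleMin⇔IsCycleMin σ zero) (λ _ → z≤n))

cycleWeightSum≡totalWeight : ∀ n g → cycleWeightSum (suc n) g ≡ totalWeight n g
cycleWeightSum≡totalWeight zero    g = trans (+-identityʳ _) (+-identityʳ _)
cycleWeightSum≡totalWeight (suc n) g = begin
  cycleWeightSum (suc (suc n)) g
    ≡⟨ sum-permutations-suc (suc n) (cycleWeight g) ⟩
  sum (map (λ σ → cycleWeight g (suc (numCycles σ)) + suc n * cycleWeight g (numCycles σ)) (permutations (suc n)))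
    ≡⟨ sum-map-cong (λ σ → cycleWeight-next (suc n) g (numCycles-pos σ)) (permutations (suc n)) ⟩
  cycleWeightSum (suc n) (nextWeight (suc n) g)
    ≡⟨ cycleWeightSum≡totalWeight n (nextWeight (suc n) g) ⟩
  totalWeight (suc n) g ∎
  where open ≡-Reasoning

numCycles≤n : ∀ (σ : Vec (Fin n) n) → numCycles σ ≤ n
numCycles≤n {n} σ =
  ≤-trans (List.length-filter (T? ∘ isCycleMin σ) (allFin n)) (≤-reflexive (List.length-tabulate (λ i → i)))

∈-map-suc-upTo : ∀ {k} → 1 ≤ k → k ≤ n → k ∈ map suc (upTo n)
∈-map-suc-upTo {k = suc k} _ 1+k≤n = ∈-map⁺ suc (∈-upTo⁺ 1+k≤n)

lhs≡cycleWeightSum : ∀ n q → lhs (suc n) q ≡ cycleWeightSum (suc n) (λ j → q ^ (j ∸ 1))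
lhs≡cycleWeightSum n q = begin
  lhs (suc n) q
    ≡⟨ sum-map-cong (λ k → *-right-comm ((k ∸ 1) !) (stirling1 (suc n) k) (q ^ (k ∸ 1))) (map suc (upTo (suc n))) ⟩
  sum (map (λ k → cycleWeight g k * stirling1 (suc n) k) (map suc (upTo (suc n))))
    ≡⟨ sum-fibres isPerm numCycles (cycleWeight g) (Unique.map⁺ suc-injective (Unique.upTo⁺ (suc n)))
         (λ σ _ → ∈-map-suc-upTo (numCycles-pos σ) (numCycles≤n σ)) (allVecs (suc n) (suc n)) ⟩
  cycleWeightSum (suc n) g ∎
  where
  open ≡-Reasoning
  g : ℕ → ℕ
  g j = q ^ (j ∸ 1)

-- Prunings of increasing trees

and-tabulate-init-last : ∀ (f : Fin (suc n) → Bool) → and (tabulate f) ≡ and (tabulate (f ∘ inject₁)) ∧ f (fromℕ n)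
and-tabulate-init-last {zero}  f = ∧-identityʳ (f zero)
and-tabulate-init-last {suc n} f =
  trans (cong (f zero ∧_) (and-tabulate-init-last (f ∘ suc))) (sym (∧-assoc (f zero) _ _))

all-allFin-init-last : ∀ (p : Fin (suc n) → Bool) → all p (allFin (suc n)) ≡ all (p ∘ inject₁) (allFin n) ∧ p (fromℕ n)
all-allFin-init-last {n} p = begin
  and (map p (tabulate (λ i → i)))
    ≡⟨ cong and (List.map-tabulate (λ i → i) p) ⟩
  and (tabulate p)
    ≡⟨ and-tabulate-init-last p ⟩
  and (tabulate (p ∘ inject₁)) ∧ p (fromℕ n)
    ≡⟨ cong (λ b → and b ∧ p (fromℕ n)) (List.map-tabulate (λ i → i) (p ∘ inject₁)) ⟨
  and (map (p ∘ inject₁) (tabulate (λ i → i))) ∧ p (fromℕ n) ∎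
  where open ≡-Reasoning

lookup-∷ʳ-inject₁ : ∀ (S : Vec A n) x i → lookup (S ∷ʳ x) (inject₁ i) ≡ lookup S i
lookup-∷ʳ-inject₁ (y ∷ S) x zero    = refl
lookup-∷ʳ-inject₁ (y ∷ S) x (suc i) = lookup-∷ʳ-inject₁ S x i

lookup-∷ʳ-fromℕ : ∀ (S : Vec A n) x → lookup (S ∷ʳ x) (fromℕ n) ≡ x
lookup-∷ʳ-fromℕ []       x = refl
lookup-∷ʳ-fromℕ (y ∷ S) x = lookup-∷ʳ-fromℕ S x

card-∷ʳ : ∀ (S : Vec Bool n) b → card (S ∷ʳ b) ≡ 𝟙 b + card S
card-∷ʳ []           true  = refl
card-∷ʳ []           false = refl
card-∷ʳ (true ∷ S)  b     = trans (cong suc (card-∷ʳ S b)) (sym (+-suc (𝟙 b) (card S)))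
card-∷ʳ (false ∷ S) b     = card-∷ʳ S b

∑-lookup≡card : ∀ (S : Vec Bool n) → ∑[ i < n ] 𝟙 (lookup S i) ≡ card S
∑-lookup≡card []           = refl
∑-lookup≡card (true ∷ S)  = cong suc (∑-lookup≡card S)
∑-lookup≡card (false ∷ S) = ∑-lookup≡card S

parent-grow-fromℕ : ∀ (t : IncTree n) p → parent (grow t p) (fromℕ n) ≡ inject₁ p
parent-grow-fromℕ {n} t p with n ≟ toℕ (fromℕ n)
... | yes _ = refl
... | no  n≢n = ⊥-elim (n≢n (sym (Fin.toℕ-fromℕ n)))

parent-grow-inject₁ : ∀ (t : IncTree n) p j → parent (grow t p) (inject₁ j) ≡ inject₁ (parent t j)
parent-grow-inject₁ {n} t p j with n ≟ toℕ (inject₁ j)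
... | yes n≡j = ⊥-elim (Fin.toℕ-inject₁-≢ j n≡j)
... | no  n≢j = cong (inject₁ ∘ parent t) (Fin.lower₁-inject₁′ j n≢j)

isPruning-grow-∷ʳ : ∀ (t : IncTree n) p (S : Vec Bool n) b →
  isPruning (grow t p) (S ∷ʳ b) ≡ isPruning t S ∧ (not b ∨ lookup S p)
isPruning-grow-∷ʳ {n} t p S b = begin
  lookup S′ (inject₁ (rootV t)) ∧ all closed′ (allFin (suc n))
    ≡⟨ cong₂ _∧_ (lookup-∷ʳ-inject₁ S b (rootV t)) (all-allFin-init-last closed′) ⟩
  lookup S (rootV t) ∧ (all (closed′ ∘ inject₁) (allFin n) ∧ closed′ (fromℕ n))
    ≡⟨ cong₂ (λ x y → lookup S (rootV t) ∧ (x ∧ y)) (cong and (List.map-cong closed-inject₁ (allFin n))) closed-fromℕ ⟩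
  lookup S (rootV t) ∧ (all closed (allFin n) ∧ (not b ∨ lookup S p))
    ≡⟨ ∧-assoc (lookup S (rootV t)) _ _ ⟨
  isPruning t S ∧ (not b ∨ lookup S p) ∎
  where
  open ≡-Reasoning
  S′ : Vec Bool (suc n)
  S′ = S ∷ʳ b
  closed : Fin n → Bool
  closed i = not (lookup S i) ∨ lookup S (parent t i)
  closed′ : Fin (suc n) → Bool
  closed′ i = not (lookup S′ i) ∨ lookup S′ (parent (grow t p) i)
  closed-inject₁ : ∀ i → closed′ (inject₁ i) ≡ closed i
  closed-inject₁ i = cong₂ (λ x y → not x ∨ y) (lookup-∷ʳ-inject₁ S b i)
    (trans (cong (lookup S′) (parent-grow-inject₁ t p i)) (lookup-∷ʳ-inject₁ S b (parent t i)))
  closed-fromℕ : closed′ (fromℕ n) ≡ not b ∨ lookup S p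
  closed-fromℕ = cong₂ (λ x y → not x ∨ y) (lookup-∷ʳ-fromℕ S b)
    (trans (cong (lookup S′) (parent-grow-fromℕ t p)) (lookup-∷ʳ-inject₁ S b p))

sum-allSubsets-∷ : ∀ n (h : Vec Bool (suc n) → ℕ) →
  sum (map h (allSubsets (suc n))) ≡ sum (map (λ S → h (true ∷ S) + h (false ∷ S)) (allSubsets n))
sum-allSubsets-∷ n h = trans (sum-map-concatMap h _ (allSubsets n))
  (sum-map-cong (λ S → cong (h (true ∷ S) +_) (+-identityʳ _)) (allSubsets n))

sum-allSubsets-∷ʳ : ∀ n (h : Vec Bool (suc n) → ℕ) →
  sum (map h (allSubsets (suc n))) ≡ sum (map (λ S → h (S ∷ʳ true) + h (S ∷ʳ false)) (allSubsets n))
sum-allSubsets-∷ʳ zero    h = trans (cong (h (true ∷ []) +_) (+-identityʳ _)) (sym (+-identityʳ _))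
sum-allSubsets-∷ʳ (suc n) h = begin
  sum (map h (allSubsets (suc (suc n))))
    ≡⟨ sum-allSubsets-∷ (suc n) h ⟩
  sum (map (λ S → h (true ∷ S) + h (false ∷ S)) (allSubsets (suc n)))
    ≡⟨ sum-allSubsets-∷ʳ n (λ S → h (true ∷ S) + h (false ∷ S)) ⟩
  sum (map (λ S → (h ((true ∷ S) ∷ʳ true) + h ((false ∷ S) ∷ʳ true))
                + (h ((true ∷ S) ∷ʳ false) + h ((false ∷ S) ∷ʳ false))) (allSubsets n))
    ≡⟨ sum-map-cong (λ S → +-interchange (h ((true ∷ S) ∷ʳ true)) _ _ _) (allSubsets n) ⟩
  sum (map (λ S → (h ((true ∷ S) ∷ʳ true) + h ((true ∷ S) ∷ʳ false))
                + (h ((false ∷ S) ∷ʳ true) + h ((false ∷ S) ∷ʳ false))) (allSubsets n))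
    ≡⟨ sum-allSubsets-∷ n (λ S → h (S ∷ʳ true) + h (S ∷ʳ false)) ⟨
  sum (map (λ S → h (S ∷ʳ true) + h (S ∷ʳ false)) (allSubsets (suc n))) ∎
  where open ≡-Reasoning

prunings : IncTree n → List (Vec Bool n)
prunings {n} t = filterᵇ (isPruning t) (allSubsets n)

pruningWeight : IncTree n → (ℕ → ℕ) → ℕ
pruningWeight t g = sum (map (g ∘ card) (prunings t))

pruningWeightSum : ℕ → (ℕ → ℕ) → ℕ
pruningWeightSum n g = sum (map (λ t → pruningWeight t g) (incTrees n))

-- The prunings of grow t p that restrict to the pruning S of t: S itself, and S with the new leaf if p ∈ S.
extensionWeight : (ℕ → ℕ) → Fin n → Vec Bool n → ℕ
extensionWeight g p S = g (card S) + 𝟙 (lookup S p) * g (suc (card S))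

pruningWeight-grow : ∀ (t : IncTree n) p g → pruningWeight (grow t p) g ≡ sum (map (extensionWeight g p) (prunings t))
pruningWeight-grow {n} t p g = begin
  pruningWeight (grow t p) g
    ≡⟨ sum-map-filterᵇ (isPruning (grow t p)) (g ∘ card) (allSubsets (suc n)) ⟩
  sum (map weight′ (allSubsets (suc n)))
    ≡⟨ sum-allSubsets-∷ʳ n weight′ ⟩
  sum (map (λ S → weight′ (S ∷ʳ true) + weight′ (S ∷ʳ false)) (allSubsets n))
    ≡⟨ sum-map-cong extensions (allSubsets n) ⟩
  sum (map (λ S → if isPruning t S then extensionWeight g p S else 0) (allSubsets n))
    ≡⟨ sum-map-filterᵇ (isPruning t) (extensionWeight g p) (allSubsets n) ⟨
  sum (map (extensionWeight g p) (prunings t)) ∎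
  where
  open ≡-Reasoning
  weight′ : Vec Bool (suc n) → ℕ
  weight′ S = if isPruning (grow t p) S then g (card S) else 0
  extensions : ∀ S → weight′ (S ∷ʳ true) + weight′ (S ∷ʳ false) ≡ (if isPruning t S then extensionWeight g p S else 0)
  extensions S rewrite isPruning-grow-∷ʳ t p S true | isPruning-grow-∷ʳ t p S false
                     | card-∷ʳ S true | card-∷ʳ S false with isPruning t S | lookup S p
  ... | true  | true  = trans (+-comm (g (suc (card S))) _) (cong (g (card S) +_) (sym (+-identityʳ _)))
  ... | true  | false = sym (+-identityʳ _)
  ... | false | _     = refl

∑-extensionWeight : ∀ g (S : Vec Bool n) → ∑[ p < n ] extensionWeight g p S ≡ nextWeight n g (card S)
∑-extensionWeight {n} g S = begin
  ∑[ p < n ] (g (card S) + 𝟙 (lookup S p) * g (suc (card S)))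
    ≡⟨ ∑-distrib-+ (λ _ → g (card S)) (λ p → 𝟙 (lookup S p) * g (suc (card S))) ⟩
  ∑[ p < n ] g (card S) + ∑[ p < n ] (𝟙 (lookup S p) * g (suc (card S)))
    ≡⟨ cong₂ _+_ (∑-const n (g (card S))) (sym (*-distribʳ-sum (g (suc (card S))) (𝟙 ∘ lookup S))) ⟩
  n * g (card S) + (∑[ p < n ] 𝟙 (lookup S p)) * g (suc (card S))
    ≡⟨ cong (λ k → n * g (card S) + k * g (suc (card S))) (∑-lookup≡card S) ⟩
  nextWeight n g (card S) ∎
  where open ≡-Reasoning

pruningWeightSum-suc : ∀ n g → pruningWeightSum (suc (suc n)) g ≡ pruningWeightSum (suc n) (nextWeight (suc n) g)
pruningWeightSum-suc n g = begin
  pruningWeightSum (suc (suc n)) g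
    ≡⟨ sum-map-concatMap (λ t → pruningWeight t g) (λ t → map (grow t) (allFin (suc n))) (incTrees (suc n)) ⟩
  sum (map (λ t → sum (map (λ t′ → pruningWeight t′ g) (map (grow t) (allFin (suc n))))) (incTrees (suc n)))
    ≡⟨ sum-map-cong grown (incTrees (suc n)) ⟩
  pruningWeightSum (suc n) (nextWeight (suc n) g) ∎
  where
  open ≡-Reasoning
  grown : ∀ t → sum (map (λ t′ → pruningWeight t′ g) (map (grow t) (allFin (suc n)))) ≡ pruningWeight t (nextWeight (suc n) g)
  grown t = begin
    sum (map (λ t′ → pruningWeight t′ g) (map (grow t) (allFin (suc n))))
      ≡⟨ cong sum (List.map-∘ (allFin (suc n))) ⟨
    sum (map (λ p → pruningWeight (grow t p) g) (allFin (suc n)))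
      ≡⟨ sum-map-allFin (λ p → pruningWeight (grow t p) g) ⟩
    ∑[ p < suc n ] pruningWeight (grow t p) g
      ≡⟨ sum-cong-≗ (λ p → pruningWeight-grow t p g) ⟩
    ∑[ p < suc n ] sum (map (extensionWeight g p) (prunings t))
      ≡⟨ ∑-sum-map-comm (extensionWeight g) (prunings t) ⟩
    sum (map (λ S → ∑[ p < suc n ] extensionWeight g p S) (prunings t))
      ≡⟨ sum-map-cong (∑-extensionWeight g) (prunings t) ⟩
    pruningWeight t (nextWeight (suc n) g) ∎

pruningWeightSum≡totalWeight : ∀ n g → pruningWeightSum (suc n) g ≡ totalWeight n g
pruningWeightSum≡totalWeight zero    g = trans (+-identityʳ _) (+-identityʳ _)
pruningWeightSum≡totalWeight (suc n) g =
  trans (pruningWeightSum-suc n g) (pruningWeightSum≡totalWeight n (nextWeight (suc n) g))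

mainTheorem3 : (n : ℕ) → 1 ≤ n → (q : ℕ) →
    lhs n q ≡ sum (map (λ T → rgf T q) (incTrees n))
mainTheorem3 (suc n) _ q = begin
  lhs (suc n) q                        ≡⟨ lhs≡cycleWeightSum n q ⟩
  cycleWeightSum (suc n) g             ≡⟨ cycleWeightSum≡totalWeight n g ⟩
  totalWeight n g                      ≡⟨ pruningWeightSum≡totalWeight n g ⟨
  pruningWeightSum (suc n) g           ∎
  where
  open ≡-Reasoning
  g : ℕ → ℕ
  g j = q ^ (j ∸ 1)
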